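{- Let $x\in\{a,b\}^\mathbb{Z}$ be the bi-infinite word $x=\lim_{k\to\infty}\varphi^{2k}(b.a)$ and let $\mathcal{A}$ be the DFAO described in the context. Then $x_n=\mathcal{A}(\operatorname{rep}_\mathcal{F}(n))$ for all $n\in\mathbb{Z}$.
   Context: $\varphi$ is the morphism $a\mapsto ab$, $b\mapsto a$. The bi-infinite word $x=(x_n)_{n\in\mathbb{Z}}$ is defined by: for every $k\ge0$, $x_{ -|\varphi^{2k}(b)|}\cdots x_{ -2}x_{ -1}=\varphi^{2k}(b)$ and $x_0x_1\cdots x_{|\varphi^{2k}(a)|-1}=\varphi^{2k}(a)$ (consistent since $\varphi^2(b)=ab$ ends in $b$ and $\varphi^2(a)=aba$ begins with $a$). The DFAO $\mathcal{A}$ has states $\textsc{start},a,b$, input alphabet $\{0,1\}$, initial state $\textsc{start}$, transitions $\delta(\textsc{start},0)=a$, $\delta(\textsc{start},1)=b$, $\delta(a,0)=a$, $\delta(a,1)=b$, $\delta(b,0)=a$ ($\delta(b,1)$ undefined), and each state $a,b$ outputs itself; $\mathcal{A}(w)$ is the output of the state reached from $\textsc{start}$ along the path labeled $w$. Fibonacci numbers: $F_0=1$, $F_1=1$, $F_{n+2}=F_{n+1}+F_n$ for $n\ge0$. For an odd-length binary word $w=w_{2k+1}\cdots w_1$ (indexed right to left), $\operatorname{val}_\mathcal{F}(w)=\sum_{i=1}^{2k}w_iF_i-w_{2k+1}F_{2k}$. For $n\in\mathbb{Z}$, $\operatorname{rep}_\mathcal{F}(n)$ is the unique odd-length binary word with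 no factor $11$, not beginning with $000$ or $101$, and with $\operatorname{val}_\mathcal{F}(\operatorname{rep}_\mathcal{F}(n))=n$. -}

module Defs where

open import Data.Nat using (ℕ; zero; suc; _+_; _*_)
open import Data.Integer as ℤ using (ℤ; +_; -[1+_])
open import Data.List using (List; []; _∷_; _++_; length; reverse; concatMap)
open import Data.Maybe using (Maybe; just; nothing; _>>=_)
open import Data.Product using (∃; _×_)
open import Data.Empty using (⊥)
open import Data.Unit using (⊤)
open import Relation.Binary.PropositionalEquality using (_≡_)
open import Relation.Nullary using (¬_)

data Letter : Set where
  a b : Letter

φ₁ : Letter → List Letter
φ₁ a = a ∷ b ∷ []
φ₁ b = a ∷ []

φ : List Letter → List Letter
φ = concatMap φ₁

φ^ : ℕ → List Letter → List Letter
φ^ zero    w = w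
φ^ (suc n) w = φ (φ^ n w)

-- i-th letter (0-based) of a word, with a default for out-of-range
-- indices (only ever used in range, see x below)
nth : List Letter → ℕ → Letter
nth []       _       = a
nth (c ∷ _)  zero    = c
nth (_ ∷ cs) (suc i) = nth cs i

-- The bi-infinite word x = lim φ^{2k}(b.a):
--   x_0 x_1 ⋯ x_{|φ^{2k}(a)|-1} = φ^{2k}(a),
--   x_{-|φ^{2k}(b)|} ⋯ x_{-1}   = φ^{2k}(b).
-- For n ≥ 0 we read x_n in φ^{2(n+1)}(a), whose length F_{2n+3} > n;
-- for n = -(m+1) we read it in φ^{2(m+1)}(b), whose length F_{2m+2} > m,
-- counting from the end (x_{-1} is the last letter).

x : ℤ → Letter
x (+ n)     = nth (φ^ (2 * suc n) (a ∷ [])) n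
x -[1+ m ]  = nth (reverse (φ^ (2 * suc m) (b ∷ []))) m

data Digit : Set where
  d0 d1 : Digit

data State : Set where
  start sa sb : State

δ : State → Digit → Maybe State
δ start d0 = just sa
δ start d1 = just sb
δ sa    d0 = just sa
δ sa    d1 = just sb
δ sb    d0 = just sa
δ sb    d1 = nothing

run : State → List Digit → Maybe State
run q []       = just q
run q (d ∷ ds) = δ q d >>= λ q′ → run q′ ds

out : State → Maybe Letter
out start = nothing   -- the state START has no output in the paper
out sa    = just a
out sb    = just b

𝒜 : List Digit → Maybe Letter
𝒜 w = run start w >>= out

F : ℕ → ℕ
F zero          = 1
F (suc zero)    = 1
F (suc (suc n)) = F (suc n) + F n

digit : Digit → ℕ
digit d0 = 0
digit d1 = 1

-- Words are lists in reading order: w = w_{m} ⋯ w_1 (most significant first).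
-- valPos w = Σ_{i=1}^{m} w_i F_i
valPos : List Digit → ℕ
valPos []       = 0
valPos (d ∷ ds) = digit d * F (suc (length ds)) + valPos ds

-- val_F(w_{2k+1} ⋯ w_1) = Σ_{i=1}^{2k} w_i F_i − w_{2k+1} F_{2k}
valF : List Digit → ℤ
valF []       = + 0   -- irrelevant: only odd-length words are considered
valF (d ∷ ds) = + valPos ds ℤ.- + (digit d * F (length ds))

OddLength : List Digit → Set
OddLength w = ∃ λ k → length w ≡ suc (2 * k)

Has11 : List Digit → Set
Has11 []              = ⊥
Has11 (_ ∷ [])        = ⊥
Has11 (d1 ∷ d1 ∷ _)   = ⊤
Has11 (_ ∷ d ∷ ds)    = Has11 (d ∷ ds)

BadPrefix : List Digit → Set
BadPrefix (d0 ∷ d0 ∷ d0 ∷ _) = ⊤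
BadPrefix (d1 ∷ d0 ∷ d1 ∷ _) = ⊤
BadPrefix _                  = ⊥

IsRepF : ℤ → List Digit → Set
IsRepF n w = OddLength w × ¬ Has11 w × ¬ BadPrefix w × valF w ≡ n

-- Since φ^{n+1}(a) = φ^n(a) φ^n(b) and φ^{n+1}(b) = φ^n(a), of lengths F_{n+1} and F_n, a
-- Fibonacci word u of length n without factor 11 addresses a position of φ^n(a): a leading
-- 0 stays in the prefix φ^{n-1}(a), a leading 10 skips it and continues in φ^{n-2}(a). The
-- letter found there is the letter of the last digit of u, which is exactly what 𝒜 outputs.
-- For n ≥ 0 this reads x_n in a prefix of x; for 1 0 u of even length 2k the value
-- valPos u − F_{2k} counts valPos u from the front of the suffix φ^{2k}(b) = φ^{2k−1}(a).
module Submission where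

open import Defs
open import Data.Empty using (⊥-elim)
open import Data.Integer as ℤ using (ℤ; +_; -[1+_]; _⊖_)
import Data.Integer.Properties as ℤ
open import Data.List using (List; []; _∷_; _++_; length; reverse)
open import Data.List.Properties using (length-++; ++-assoc; ++-identityʳ; unfold-reverse; length-reverse; reverse-++)
open import Data.Maybe using (just; _>>=_)
open import Data.Nat using (ℕ; zero; suc; _+_; _*_; _∸_; _≤_; _<_; _≤′_; ≤′-reflexive; ≤′-step; z≤n; s≤s)
open import Data.Nat.Properties
open import Data.Product using (∃; _,_)
open import Data.Sum using (inj₁; inj₂)
open import Data.Unit using (tt)
open import Function using (_∘_)
open import Relation.Binary.PropositionalEquality using (_≡_; refl; sym; trans; cong; cong₂; subst; module ≡-Reasoning)
open import Relation.Nullary using (¬_)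

open ≡-Reasoning

nth-++ˡ : ∀ (l r : List Letter) {i} → i < length l → nth (l ++ r) i ≡ nth l i
nth-++ˡ (_ ∷ _) r {zero}  _       = refl
nth-++ˡ (_ ∷ l) r {suc i} (s≤s p) = nth-++ˡ l r p

nth-++ʳ : ∀ (l r : List Letter) i → nth (l ++ r) (length l + i) ≡ nth r i
nth-++ʳ []      r i = refl
nth-++ʳ (_ ∷ l) r i = nth-++ʳ l r i

nth-reverse : ∀ (l : List Letter) i j → suc (i + j) ≡ length l → nth (reverse l) j ≡ nth l i
nth-reverse (c ∷ l) zero j e = begin
  nth (reverse (c ∷ l)) j                            ≡⟨ cong (λ w → nth w j) (unfold-reverse c l) ⟩
  nth (reverse l ++ c ∷ []) j                        ≡⟨ cong (nth (reverse l ++ c ∷ [])) j≡ ⟩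
  nth (reverse l ++ c ∷ []) (length (reverse l) + 0) ≡⟨ nth-++ʳ (reverse l) (c ∷ []) 0 ⟩
  c                                                  ∎
  where
  j≡ : j ≡ length (reverse l) + 0
  j≡ = trans (suc-injective e) (sym (trans (+-identityʳ _) (length-reverse l)))
nth-reverse (c ∷ l) (suc i) j e = begin
  nth (reverse (c ∷ l)) j      ≡⟨ cong (λ w → nth w j) (unfold-reverse c l) ⟩
  nth (reverse l ++ c ∷ []) j  ≡⟨ nth-++ˡ (reverse l) (c ∷ []) j<l ⟩
  nth (reverse l) j            ≡⟨ nth-reverse l i j (suc-injective e) ⟩
  nth l i                      ∎
  where
  j<l : j < length (reverse l)
  j<l = subst (j <_) (trans (suc-injective e) (sym (length-reverse l))) (s≤s (m≤n+m j i))

module PrefixChain {u v : ℕ → List Letter} (grow : ∀ j → u (suc j) ≡ u j ++ v j) where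

  prefix : ∀ {i j} → i ≤′ j → ∃ λ t → u j ≡ u i ++ t
  prefix (≤′-reflexive refl) = [] , sym (++-identityʳ _)
  prefix {i} {suc j} (≤′-step i≤j) with prefix i≤j
  ... | t , e = t ++ v j , (begin
    u (suc j)          ≡⟨ grow j ⟩
    u j ++ v j         ≡⟨ cong (_++ v j) e ⟩
    (u i ++ t) ++ v j  ≡⟨ ++-assoc (u i) t (v j) ⟩
    u i ++ t ++ v j    ∎)

  nth-prefix : ∀ {i j n} → i ≤ j → n < length (u i) → nth (u j) n ≡ nth (u i) n
  nth-prefix {i} {j} {n} i≤j n<l with prefix (≤⇒≤′ i≤j)
  ... | t , e = trans (cong (λ w → nth w n) e) (nth-++ˡ (u i) t n<l)

  nth-agree : ∀ i j {n} → n < length (u i) → n < length (u j) → nth (u i) n ≡ nth (u j) n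
  nth-agree i j n<i n<j with ≤-total i j
  ... | inj₁ i≤j = sym (nth-prefix i≤j n<i)
  ... | inj₂ j≤i = nth-prefix j≤i n<j

open PrefixChain using (nth-agree)

φ-++ : ∀ u v → φ (u ++ v) ≡ φ u ++ φ v
φ-++ []      v = refl
φ-++ (c ∷ u) v = trans (cong (φ₁ c ++_) (φ-++ u v)) (sym (++-assoc (φ₁ c) (φ u) (φ v)))

φ^-++ : ∀ n u v → φ^ n (u ++ v) ≡ φ^ n u ++ φ^ n v
φ^-++ zero    u v = refl
φ^-++ (suc n) u v = trans (cong φ (φ^-++ n u v)) (φ-++ (φ^ n u) (φ^ n v))

φ^-suc : ∀ n w → φ^ (suc n) w ≡ φ^ n (φ w)
φ^-suc zero    w = refl
φ^-suc (suc n) w = cong φ (φ^-suc n w)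

φᵃ φᵇ : ℕ → List Letter
φᵃ n = φ^ n (a ∷ [])
φᵇ n = φ^ n (b ∷ [])

φᵃ-suc : ∀ n → φᵃ (suc n) ≡ φᵃ n ++ φᵇ n
φᵃ-suc n = trans (φ^-suc n (a ∷ [])) (φ^-++ n (a ∷ []) (b ∷ []))

φᵇ-suc : ∀ n → φᵇ (suc n) ≡ φᵃ n
φᵇ-suc n = φ^-suc n (b ∷ [])

length-φᵃ : ∀ n → length (φᵃ n) ≡ F (suc n)
length-φᵇ : ∀ n → length (φᵇ n) ≡ F n
length-φᵃ zero    = refl
length-φᵃ (suc n) = begin
  length (φᵃ (suc n))           ≡⟨ cong length (φᵃ-suc n) ⟩
  length (φᵃ n ++ φᵇ n)         ≡⟨ length-++ (φᵃ n) ⟩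
  length (φᵃ n) + length (φᵇ n) ≡⟨ cong₂ _+_ (length-φᵃ n) (length-φᵇ n) ⟩
  F (suc n) + F n               ∎
length-φᵇ zero    = refl
length-φᵇ (suc n) = trans (cong length (φᵇ-suc n)) (length-φᵃ n)

F-≤-suc : ∀ n → F n ≤ F (suc n)
F-≤-suc zero    = ≤-refl
F-≤-suc (suc n) = m≤m+n (F (suc n)) (F n)

F-mono : ∀ {i j} → i ≤ j → F i ≤ F j
F-mono i≤j = mono′ (≤⇒≤′ i≤j)
  where
  mono′ : ∀ {i j} → i ≤′ j → F i ≤ F j
  mono′ (≤′-reflexive refl)        = ≤-refl
  mono′ {i} {suc j} (≤′-step i≤j) = ≤-trans (mono′ i≤j) (F-≤-suc j)

n<F[1+n] : ∀ n → n < F (suc n)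
n<F[1+n] zero    = s≤s z≤n
n<F[1+n] (suc n) = subst (_≤ F (suc n) + F n) (+-comm (suc n) 1)
                         (+-mono-≤ (n<F[1+n] n) (F-mono {0} {n} z≤n))

≤⇒<F[1+] : ∀ {n j} → n ≤ j → n < F (suc j)
≤⇒<F[1+] {n} n≤j = ≤-trans (n<F[1+n] n) (F-mono (s≤s n≤j))

nth-φᵃ-suc : ∀ n {i} → i < F (suc n) → nth (φᵃ (suc n)) i ≡ nth (φᵃ n) i
nth-φᵃ-suc n {i} i<F = begin
  nth (φᵃ (suc n)) i     ≡⟨ cong (λ w → nth w i) (φᵃ-suc n) ⟩
  nth (φᵃ n ++ φᵇ n) i   ≡⟨ nth-++ˡ (φᵃ n) (φᵇ n) (subst (i <_) (sym (length-φᵃ n)) i<F) ⟩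
  nth (φᵃ n) i           ∎

nth-φᵃ-2+ : ∀ n i → nth (φᵃ (2 + n)) (F (2 + n) + i) ≡ nth (φᵃ n) i
nth-φᵃ-2+ n i = begin
  nth (φᵃ (2 + n)) (F (2 + n) + i)                         ≡⟨ cong (λ w → nth w (F (2 + n) + i)) (φᵃ-suc (suc n)) ⟩
  nth (φᵃ (suc n) ++ φᵇ (suc n)) (F (2 + n) + i)           ≡⟨ cong (λ k → nth (φᵃ (suc n) ++ φᵇ (suc n)) (k + i)) (sym (length-φᵃ (suc n))) ⟩
  nth (φᵃ (suc n) ++ φᵇ (suc n)) (length (φᵃ (suc n)) + i) ≡⟨ nth-++ʳ (φᵃ (suc n)) (φᵇ (suc n)) i ⟩
  nth (φᵇ (suc n)) i                                       ≡⟨ cong (λ w → nth w i) (φᵇ-suc n) ⟩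
  nth (φᵃ n) i                                             ∎

Has11-∷ : ∀ d r → Has11 r → Has11 (d ∷ r)
Has11-∷ d0 (_ ∷ _)  h = h
Has11-∷ d1 (d0 ∷ _) h = h
Has11-∷ d1 (d1 ∷ _) _ = tt

¬Has11-tail : ∀ d r → ¬ Has11 (d ∷ r) → ¬ Has11 r
¬Has11-tail d r h = h ∘ Has11-∷ d r

valPos-10∷ : ∀ r → valPos (d1 ∷ d0 ∷ r) ≡ F (2 + length r) + valPos r
valPos-10∷ r = cong (_+ valPos r) (*-identityˡ (F (2 + length r)))

valPos-< : ∀ u → ¬ Has11 u → valPos u < F (suc (length u))
valPos-< []            _ = s≤s z≤n
valPos-< (d0 ∷ u)      h = ≤-trans (valPos-< u (¬Has11-tail d0 u h)) (F-≤-suc (suc (length u)))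
valPos-< (d1 ∷ [])     _ = s≤s (s≤s z≤n)
valPos-< (d1 ∷ d1 ∷ _) h = ⊥-elim (h tt)
valPos-< (d1 ∷ d0 ∷ r) h = subst (_< F (3 + length r)) (sym (valPos-10∷ r))
  (+-monoʳ-< (F (2 + length r)) (valPos-< r (¬Has11-tail d0 r (¬Has11-tail d1 (d0 ∷ r) h))))

letter : Digit → Letter
letter d0 = a
letter d1 = b

lastLetter : List Digit → Letter
lastLetter []           = a
lastLetter (d ∷ [])     = letter d
lastLetter (_ ∷ d ∷ ds) = lastLetter (d ∷ ds)

lastLetter-0∷ : ∀ u → lastLetter (d0 ∷ u) ≡ lastLetter u
lastLetter-0∷ []      = refl
lastLetter-0∷ (_ ∷ _) = refl

nth-φᵃ-valPos : ∀ u → ¬ Has11 u → nth (φᵃ (length u)) (valPos u) ≡ lastLetter u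
nth-φᵃ-valPos []            _ = refl
nth-φᵃ-valPos (d0 ∷ u)      h = begin
  nth (φᵃ (suc (length u))) (valPos u) ≡⟨ nth-φᵃ-suc (length u) (valPos-< u (¬Has11-tail d0 u h)) ⟩
  nth (φᵃ (length u)) (valPos u)       ≡⟨ nth-φᵃ-valPos u (¬Has11-tail d0 u h) ⟩
  lastLetter u                         ≡⟨ sym (lastLetter-0∷ u) ⟩
  lastLetter (d0 ∷ u)                  ∎
nth-φᵃ-valPos (d1 ∷ [])     _ = refl
nth-φᵃ-valPos (d1 ∷ d1 ∷ _) h = ⊥-elim (h tt)
nth-φᵃ-valPos (d1 ∷ d0 ∷ r) h = begin
  nth (φᵃ (2 + length r)) (valPos (d1 ∷ d0 ∷ r))        ≡⟨ cong (nth (φᵃ (2 + length r))) (valPos-10∷ r) ⟩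
  nth (φᵃ (2 + length r)) (F (2 + length r) + valPos r) ≡⟨ nth-φᵃ-2+ (length r) (valPos r) ⟩
  nth (φᵃ (length r)) (valPos r)                        ≡⟨ nth-φᵃ-valPos r (¬Has11-tail d0 r (¬Has11-tail d1 (d0 ∷ r) h)) ⟩
  lastLetter r                                          ≡⟨ sym (lastLetter-0∷ r) ⟩
  lastLetter (d0 ∷ r)                                   ∎

state : Digit → State
state d0 = sa
state d1 = sb

run-lastLetter : ∀ d ds → ¬ Has11 (d ∷ ds) → (run (state d) ds >>= out) ≡ just (lastLetter (d ∷ ds))
run-lastLetter d0 []         _ = refl
run-lastLetter d1 []         _ = refl
run-lastLetter d0 (d0 ∷ ds)  h = run-lastLetter d0 ds h
run-lastLetter d0 (d1 ∷ ds)  h = run-lastLetter d1 ds h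
run-lastLetter d1 (d0 ∷ ds)  h = run-lastLetter d0 ds h
run-lastLetter d1 (d1 ∷ _)   h = ⊥-elim (h tt)

𝒜-lastLetter : ∀ d ds → ¬ Has11 (d ∷ ds) → 𝒜 (d ∷ ds) ≡ just (lastLetter (d ∷ ds))
𝒜-lastLetter d0 = run-lastLetter d0
𝒜-lastLetter d1 = run-lastLetter d1

x-+ : ∀ i {n} → n < F (suc i) → x (+ n) ≡ nth (φᵃ i) n
x-+ i {n} n<F = nth-agree {u = φᵃ} φᵃ-suc (2 * suc n) i
                          (bound (2 * suc n) (≤⇒<F[1+] (m≤n⇒m≤1+n (m≤m+n n _)))) (bound i n<F)
  where
  bound : ∀ j → n < F (suc j) → n < length (φᵃ j)
  bound j = subst (n <_) (sym (length-φᵃ j))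

-- φ^{2k+2}(b) = φ^{2k}(a) φ^{2k}(b): the even iterates of b are suffixes of one another.
x--[1+] : ∀ k {m} → m < F (2 * suc k) → x -[1+ m ] ≡ nth (reverse (φᵇ (2 * suc k))) m
x--[1+] k {m} m<F = nth-agree {u = λ j → reverse (φᵇ (2 * suc j))} grow m k
                             (bound m (≤⇒<F[1+] (m≤m+n m _))) (bound k m<F)
  where
  grow : ∀ j → reverse (φᵇ (2 * suc (suc j))) ≡ reverse (φᵇ (2 * suc j)) ++ reverse (φᵃ (2 * suc j))
  grow j = begin
    reverse (φᵇ (2 * suc (suc j)))              ≡⟨ cong (reverse ∘ φᵇ) (*-suc 2 (suc j)) ⟩
    reverse (φᵇ (2 + 2 * suc j))                ≡⟨ cong reverse (trans (φᵇ-suc (suc (2 * suc j))) (φᵃ-suc (2 * suc j))) ⟩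
    reverse (φᵃ (2 * suc j) ++ φᵇ (2 * suc j))  ≡⟨ reverse-++ (φᵃ (2 * suc j)) (φᵇ (2 * suc j)) ⟩
    reverse (φᵇ (2 * suc j)) ++ reverse (φᵃ (2 * suc j)) ∎
  bound : ∀ j → m < F (2 * suc j) → m < length (reverse (φᵇ (2 * suc j)))
  bound j = subst (m <_) (sym (trans (length-reverse (φᵇ (2 * suc j))) (length-φᵇ (2 * suc j))))

+m-+[1+m+n]≡-[1+n] : ∀ m n → + m ℤ.- + suc (m + n) ≡ -[1+ n ]
+m-+[1+m+n]≡-[1+n] m n = begin
  + m ℤ.- + suc (m + n)   ≡⟨ ℤ.[+m]-[+n]≡m⊖n m (suc (m + n)) ⟩
  m ⊖ suc (m + n)         ≡⟨ cong₂ _⊖_ (sym (+-identityʳ m)) (sym (+-suc m n)) ⟩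
  (m + 0) ⊖ (m + suc n)   ≡⟨ ℤ.+-cancelˡ-⊖ m 0 (suc n) ⟩
  -[1+ n ]                ∎

x-valF-0∷ : ∀ u → ¬ Has11 u → x (valF (d0 ∷ u)) ≡ lastLetter (d0 ∷ u)
x-valF-0∷ u h = begin
  x (valF (d0 ∷ u))               ≡⟨ cong x (ℤ.+-identityʳ (+ valPos u)) ⟩
  x (+ valPos u)                  ≡⟨ x-+ (length u) (valPos-< u h) ⟩
  nth (φᵃ (length u)) (valPos u)  ≡⟨ nth-φᵃ-valPos u h ⟩
  lastLetter u                    ≡⟨ sym (lastLetter-0∷ u) ⟩
  lastLetter (d0 ∷ u)             ∎

x-valF-10∷ : ∀ k u → suc (length u) ≡ 2 * suc k → ¬ Has11 u →
             x (valF (d1 ∷ d0 ∷ u)) ≡ lastLetter (d1 ∷ d0 ∷ u)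
x-valF-10∷ k u len h = begin
  x (valF (d1 ∷ d0 ∷ u))                 ≡⟨ cong x valF≡ ⟩
  x -[1+ m ]                             ≡⟨ x--[1+] k (subst (m <_) v+m≡N (s≤s (m≤n+m m v))) ⟩
  nth (reverse (φᵇ (2 * suc k))) m       ≡⟨ nth-reverse (φᵇ (2 * suc k)) v m (trans v+m≡N (sym (length-φᵇ (2 * suc k)))) ⟩
  nth (φᵇ (2 * suc k)) v                 ≡⟨ cong (λ j → nth (φᵇ j) v) (sym len) ⟩
  nth (φᵇ (suc (length u))) v            ≡⟨ cong (λ w → nth w v) (φᵇ-suc (length u)) ⟩
  nth (φᵃ (length u)) v                  ≡⟨ nth-φᵃ-valPos u h ⟩
  lastLetter u                           ≡⟨ sym (lastLetter-0∷ u) ⟩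
  lastLetter (d0 ∷ u)                    ∎
  where
  v = valPos u
  N = F (2 * suc k)
  m = N ∸ suc v
  v+m≡N : suc (v + m) ≡ N
  v+m≡N = m+[n∸m]≡n (subst (λ j → v < F j) len (valPos-< u h))
  valF≡ : valF (d1 ∷ d0 ∷ u) ≡ -[1+ m ]
  valF≡ = trans (cong (λ z → + v ℤ.- + z) (trans (*-identityˡ _) (trans (cong F len) (sym v+m≡N))))
                (+m-+[1+m+n]≡-[1+n] v m)

-- The excluded prefixes 000 and 101 only serve the uniqueness of rep_F.
proposition3 : (n : ℤ) (w : List Digit) → IsRepF n w → 𝒜 w ≡ just (x n)
proposition3 _ []            ((_ , ()) , _)
proposition3 _ (d0 ∷ u)      (_ , no11 , _ , refl) =
  trans (𝒜-lastLetter d0 u no11) (cong just (sym (x-valF-0∷ u (¬Has11-tail d0 u no11))))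
proposition3 _ (d1 ∷ [])     (_ , _ , _ , refl) = refl
proposition3 _ (d1 ∷ d1 ∷ _) (_ , no11 , _) = ⊥-elim (no11 tt)
proposition3 _ (d1 ∷ d0 ∷ u) ((zero , ()) , _)
proposition3 _ (d1 ∷ d0 ∷ u) ((suc k , odd) , no11 , _ , refl) =
  trans (𝒜-lastLetter d1 (d0 ∷ u) no11)
        (cong just (sym (x-valF-10∷ k u (suc-injective odd) no11u)))
  where
  no11u : ¬ Has11 u
  no11u = ¬Has11-tail d0 u (¬Has11-tail d1 (d0 ∷ u) no11)
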